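{- Let $n\ge 1$ and let $\mathcal{E}_n$ be the Fomin–Kirillov quadratic algebra. For $p\in\{1,\ldots,n\}$ define the $K$-theoretic Dunkl element \[\kappa_p:=1-(1+[p-1,p])(1+[p-2,p])\cdots(1+[1p])(1+[np])(1+[n-1,p])\cdots(1+[p+1,p])\in\mathcal{E}_n.\] Then $\kappa_p\kappa_q=\kappa_q\kappa_p$ in $\mathcal{E}_n$ for all $p,q\in\{1,\ldots,n\}$.
   Context: The quadratic algebra $\mathcal{E}_n$ is the associative algebra (over $\mathbb{Z}$, with unit $1$) with generators $[ij]$ for $1\le i\ne j\le n$, subject to the relations: (i) $[ij]+[ji]=0$; (ii) $[ij]^2=0$; (iii) $[ij][jk]+[jk][ki]+[ki][ij]=0$; (iv) $[ij][kl]=[kl][ij]$, for all pairwise distinct $i,j,k,l$. In the definition of $\kappa_p$ the product runs over all $i\neq p$, in the order $i=p-1,p-2,\ldots,1,n,n-1,\ldots,p+1$. -}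

module Defs where

open import Data.Nat using (ℕ; _<?_)
open import Data.Fin using (Fin; toℕ; _≟_)
open import Data.List using (List; filter; reverse; map; foldr; _++_; allFin)
open import Relation.Binary.PropositionalEquality using (_≢_)
open import Relation.Nullary using (yes; no)

-- Terms of the free associative unital ring (= free ℤ-algebra) on the
-- generators [ij], i ≢ j, i,j ∈ Fin n (Fin n ≅ {1,…,n} via i ↦ toℕ i + 1).
infixl 6 _⊕_
infixl 7 _⊗_
data Term (n : ℕ) : Set where
  gen : (i j : Fin n) → .(i ≢ j) → Term n
  𝟘 𝟙 : Term n
  _⊕_ _⊗_ : Term n → Term n → Term n
  ⊖_ : Term n → Term n

-- The congruence presenting 𝓔ₙ: ring axioms + the defining relations (i)–(iv).
-- Two terms are equal in 𝓔ₙ iff they are related by _≈_.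
infix 4 _≈_
data _≈_ {n : ℕ} : Term n → Term n → Set where
  refl≈  : ∀ {x} → x ≈ x
  sym≈   : ∀ {x y} → x ≈ y → y ≈ x
  trans≈ : ∀ {x y z} → x ≈ y → y ≈ z → x ≈ z
  ⊕-cong : ∀ {x x' y y'} → x ≈ x' → y ≈ y' → x ⊕ y ≈ x' ⊕ y'
  ⊗-cong : ∀ {x x' y y'} → x ≈ x' → y ≈ y' → x ⊗ y ≈ x' ⊗ y'
  ⊖-cong : ∀ {x x'} → x ≈ x' → ⊖ x ≈ ⊖ x'
  ⊕-assoc : ∀ x y z → (x ⊕ y) ⊕ z ≈ x ⊕ (y ⊕ z)
  ⊕-comm  : ∀ x y → x ⊕ y ≈ y ⊕ x
  ⊕-idˡ   : ∀ x → 𝟘 ⊕ x ≈ x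
  ⊖-invˡ  : ∀ x → (⊖ x) ⊕ x ≈ 𝟘
  ⊗-assoc : ∀ x y z → (x ⊗ y) ⊗ z ≈ x ⊗ (y ⊗ z)
  ⊗-idˡ   : ∀ x → 𝟙 ⊗ x ≈ x
  ⊗-idʳ   : ∀ x → x ⊗ 𝟙 ≈ x
  distribˡ : ∀ x y z → x ⊗ (y ⊕ z) ≈ (x ⊗ y) ⊕ (x ⊗ z)
  distribʳ : ∀ x y z → (y ⊕ z) ⊗ x ≈ (y ⊗ x) ⊕ (z ⊗ x)
  rel-i   : ∀ i j (p : i ≢ j) (q : j ≢ i) → gen i j p ⊕ gen j i q ≈ 𝟘
  rel-ii  : ∀ i j (p : i ≢ j) → gen i j p ⊗ gen i j p ≈ 𝟘
  rel-iii : ∀ i j k (ij : i ≢ j) (jk : j ≢ k) (ki : k ≢ i) →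
            (gen i j ij ⊗ gen j k jk) ⊕ (gen j k jk ⊗ gen k i ki) ⊕ (gen k i ki ⊗ gen i j ij) ≈ 𝟘
  rel-iv  : ∀ i j k l (ij : i ≢ j) (kl : k ≢ l) (ik : i ≢ k) (il : i ≢ l)
              (jk : j ≢ k) (jl : j ≢ l) →
            gen i j ij ⊗ gen k l kl ≈ gen k l kl ⊗ gen i j ij

-- The indices i ≠ p in the order p-1, p-2, …, 1, n, n-1, …, p+1.
dunklOrder : {n : ℕ} → Fin n → List (Fin n)
dunklOrder {n} p =
  filter (λ j → toℕ j <? toℕ p) (reverse (allFin n)) ++
  filter (λ j → toℕ p <? toℕ j) (reverse (allFin n))

-- The factor 1 + [i p] (the case i = p never occurs for i ∈ dunklOrder p).
factor : {n : ℕ} → Fin n → Fin n → Term n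
factor p i with i ≟ p
... | yes _ = 𝟙
... | no i≢p = 𝟙 ⊕ gen i p i≢p

κ : {n : ℕ} → Fin n → Term n
κ p = 𝟙 ⊕ (⊖ foldr _⊗_ 𝟙 (map (factor p) (dunklOrder p)))

{-# OPTIONS --safe #-}
module Submission where

open import Algebra.Bundles using (Monoid; Ring)
open import Data.Fin using (Fin; _<_; _>_; _≟_)
open import Data.Fin.Properties using (_<?_; <-cmp; <-trans; <-asym; <-irrefl; <⇒≢)
open import Data.List using (List; []; _∷_; _++_; foldr; map; filter; reverse; allFin)
open import Data.List.Membership.Propositional using (_∈_)
open import Data.List.Membership.Propositional.Properties using (∈-allFin; ∈-filter⁺; ∈-filter⁻)
open import Data.List.Properties using (map-++; ++-assoc; unfold-reverse; filter-accept; filter-reject; filter-all; filter-none; filter-≐)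
open import Data.List.Relation.Binary.Disjoint.Propositional using (Disjoint)
open import Data.List.Relation.Binary.Disjoint.Propositional.Properties using (Disjoint⇒AllAll)
import Data.List.Relation.Binary.Disjoint.Propositional.Properties as Disjoint
open import Data.List.Relation.Unary.All using (All; []; _∷_)
import Data.List.Relation.Unary.All as All
open import Data.List.Relation.Unary.All.Properties using (¬Any⇒All¬; all-filter)
import Data.List.Relation.Unary.All.Properties as All
open import Data.List.Relation.Unary.AllPairs using (AllPairs; []; _∷_)
import Data.List.Relation.Unary.AllPairs as AllPairs
import Data.List.Relation.Unary.AllPairs.Properties as AllPairs
open import Data.List.Relation.Unary.Any using (here; there)
import Data.List.Relation.Unary.Any.Properties as Any
open import Data.List.Relation.Unary.Unique.Propositional using (Unique)
import Data.List.Relation.Unary.Unique.Propositional.Properties as Unique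
open import Data.Nat using (ℕ; _≤_)
open import Data.Product using (_×_; _,_; proj₁; proj₂; swap; ∃₂)
open import Data.Empty using (⊥-elim)
open import Function using (flip)
open import Level using (0ℓ)
open import Relation.Binary using (Rel; tri<; tri≈; tri>)
open import Relation.Binary.PropositionalEquality using (_≡_; _≢_; refl; ≢-sym; module ≡-Reasoning)
import Relation.Binary.PropositionalEquality as ≡
open import Relation.Nullary using (yes; no)
open import Relation.Unary using (Pred; Decidable; _⊆_)
open import Relation.Unary.Properties using (_∩?_)

-- Write κ p = 1 - Φ p, where Φ p is the ordered product of the factors h p i = 1 + [ip] over
-- dunklOrder p; it suffices that Φ p and Φ q commute. In 𝓔ₙ the factors are unitary,
-- h p q · h q p = 1 (by (i), (ii)), satisfy the Yang–Baxter relation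
-- h p q · h p c · h q c = h q c · h p c · h p q (by (i)–(iii)), and commute when their index
-- pairs are disjoint (by (iv)). For p < q the two orders interleave as dunklOrder p = B, q, A and
-- dunklOrder q = A, p, B with A = q-1, …, p+1. Moving h p q through Φ p A · Φ q A by Yang–Baxter
-- and cancelling it against h q p gives Φ p Φ q = Φ p B · Φ q A · Φ p A · Φ q B, and symmetrically
-- Φ q Φ p = Φ q A · Φ p B · Φ q B · Φ p A; the two agree because Φ p B, Φ q A and Φ p A, Φ q B
-- involve disjoint sets of indices.

module _ {a} {A : Set a} where

  Unique-++⁻ : ∀ xs {ys : List A} → Unique (xs ++ ys) → Unique xs × Unique ys × Disjoint xs ys
  Unique-++⁻ []       ys!         = [] , ys! , λ { (() , _) }
  Unique-++⁻ (x ∷ xs) (x∉ ∷ xsys!) with Unique-++⁻ xs xsys! | All.++⁻ xs x∉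
  ... | xs! , ys! , xs#ys | x∉xs , x∉ys = x∉xs ∷ xs! , ys! , λ where
    (here refl   , v∈ys) → All.lookup x∉ys v∈ys refl
    (there v∈xs , v∈ys) → xs#ys (v∈xs , v∈ys)

  AllPairs-reverse⁺ : ∀ {r} {R : Rel A r} {xs} → AllPairs R xs → AllPairs (flip R) (reverse xs)
  AllPairs-reverse⁺ [] = []
  AllPairs-reverse⁺ {xs = x ∷ xs} (Rx ∷ Rxs) rewrite unfold-reverse x xs =
    AllPairs.++⁺ (AllPairs-reverse⁺ Rxs) ([] ∷ [])
      (All.tabulate λ y∈ → All.lookup Rx (Any.reverse⁻ y∈) ∷ [])

  filter-filter : ∀ {p q} {P : Pred A p} {Q : Pred A q} (P? : Decidable P) (Q? : Decidable Q) →
                  ∀ xs → filter P? (filter Q? xs) ≡ filter (P? ∩? Q?) xs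
  filter-filter P? Q? [] = refl
  filter-filter P? Q? (x ∷ xs) with Q? x
  ... | yes _ with P? x
  ...   | yes _ = ≡.cong (x ∷_) (filter-filter P? Q? xs)
  ...   | no _  = filter-filter P? Q? xs
  filter-filter P? Q? (x ∷ xs) | no _ with P? x
  ...   | yes _ = filter-filter P? Q? xs
  ...   | no _  = filter-filter P? Q? xs

  filter-filter-⊆ : ∀ {p q} {P : Pred A p} {Q : Pred A q} (P? : Decidable P) (Q? : Decidable Q) →
                    P ⊆ Q → ∀ xs → filter P? (filter Q? xs) ≡ filter P? xs
  filter-filter-⊆ P? Q? P⊆Q xs =
    ≡.trans (filter-filter P? Q? xs) (filter-≐ (P? ∩? Q?) P? (proj₁ , λ px → px , P⊆Q px) xs)

  filter-filter-comm : ∀ {p q} {P : Pred A p} {Q : Pred A q} (P? : Decidable P) (Q? : Decidable Q) →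
                       ∀ xs → filter P? (filter Q? xs) ≡ filter Q? (filter P? xs)
  filter-filter-comm P? Q? xs = begin
    filter P? (filter Q? xs) ≡⟨ filter-filter P? Q? xs ⟩
    filter (P? ∩? Q?) xs     ≡⟨ filter-≐ (P? ∩? Q?) (Q? ∩? P?) (swap , swap) xs ⟩
    filter (Q? ∩? P?) xs     ≡⟨ filter-filter Q? P? xs ⟨
    filter Q? (filter P? xs) ∎
    where open ≡-Reasoning

module Products {c ℓ} (M : Monoid c ℓ) where

  open Monoid M hiding (refl)
  open import Relation.Binary.Reasoning.Setoid setoid
  open import Tactic.MonoidSolver using (solve)

  ∏ : List Carrier → Carrier
  ∏ = foldr _∙_ ε

  ∏-++ : ∀ xs ys → ∏ (xs ++ ys) ≈ ∏ xs ∙ ∏ ys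
  ∏-++ []       ys = sym (identityˡ (∏ ys))
  ∏-++ (x ∷ xs) ys = trans (∙-congˡ (∏-++ xs ys)) (sym (assoc x (∏ xs) (∏ ys)))

  commutes-with-∏ : ∀ {b as} → All (λ a → b ∙ a ≈ a ∙ b) as → b ∙ ∏ as ≈ ∏ as ∙ b
  commutes-with-∏ {b} [] = trans (identityʳ b) (sym (identityˡ b))
  commutes-with-∏ {b} {a ∷ as} (ba≈ab ∷ bas≈asb) = begin
    b ∙ (a ∙ ∏ as)   ≈⟨ assoc b a (∏ as) ⟨
    b ∙ a ∙ ∏ as     ≈⟨ ∙-congʳ ba≈ab ⟩
    a ∙ b ∙ ∏ as     ≈⟨ assoc a b (∏ as) ⟩
    a ∙ (b ∙ ∏ as)   ≈⟨ ∙-congˡ (commutes-with-∏ bas≈asb) ⟩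
    a ∙ (∏ as ∙ b)   ≈⟨ assoc a (∏ as) b ⟨
    a ∙ ∏ as ∙ b     ∎

  module DunklProducts {i} {I : Set i} (h : I → I → Carrier)
    (h-unitary : ∀ {x y} → x ≢ y → h x y ∙ h y x ≈ ε)
    (h-yang-baxter : ∀ {p q c} → p ≢ q → p ≢ c → q ≢ c →
                     h p q ∙ h p c ∙ h q c ≈ h q c ∙ h p c ∙ h p q)
    (h-local : ∀ {x c y d} → x ≢ y → x ≢ d → c ≢ y → c ≢ d →
               h x c ∙ h y d ≈ h y d ∙ h x c)
    where

    Φ : I → List I → Carrier
    Φ x C = ∏ (map (h x) C)

    Φ-++ : ∀ x C D → Φ x (C ++ D) ≈ Φ x C ∙ Φ x D
    Φ-++ x C D =
      trans (reflexive (≡.cong ∏ (map-++ (h x) C D))) (∏-++ (map (h x) C) (map (h x) D))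

    h-commutes-Φ : ∀ {x c y D} → All (x ≢_) (y ∷ D) → All (c ≢_) (y ∷ D) →
                   h x c ∙ Φ y D ≈ Φ y D ∙ h x c
    h-commutes-Φ (x≢y ∷ x∉D) (c≢y ∷ c∉D) = commutes-with-∏ (All.map⁺
      (All.zipWith (λ (x≢d , c≢d) → h-local x≢y x≢d c≢y c≢d) (x∉D , c∉D)))

    Φ-commute : ∀ {x C y D} → Disjoint (x ∷ C) (y ∷ D) → Φ x C ∙ Φ y D ≈ Φ y D ∙ Φ x C
    Φ-commute x∷C#y∷D with Disjoint⇒AllAll x∷C#y∷D
    ... | x∉y∷D ∷ C∉y∷D = sym (commutes-with-∏ (All.map⁺
      (All.map (λ c∉y∷D → sym (h-commutes-Φ x∉y∷D c∉y∷D)) C∉y∷D)))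

    Φ-yang-baxter : ∀ {p q C} → Unique (p ∷ q ∷ C) →
                    h p q ∙ Φ p C ∙ Φ q C ≈ Φ q C ∙ Φ p C ∙ h p q
    Φ-yang-baxter {C = []} _ = solve M
    Φ-yang-baxter {p} {q} {c ∷ C} ((p≢q ∷ p≢c ∷ p∉C) ∷ (q≢c ∷ q∉C) ∷ (c∉C ∷ C!)) = begin
      h p q ∙ (h p c ∙ Φ p C) ∙ (h q c ∙ Φ q C)
        ≈⟨ solve M ⟩
      h p q ∙ h p c ∙ (Φ p C ∙ h q c) ∙ Φ q C
        ≈⟨ ∙-congʳ (∙-congˡ hqc-past-ΦpC) ⟨
      h p q ∙ h p c ∙ (h q c ∙ Φ p C) ∙ Φ q C
        ≈⟨ solve M ⟩
      h p q ∙ h p c ∙ h q c ∙ (Φ p C ∙ Φ q C)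
        ≈⟨ ∙-congʳ (h-yang-baxter p≢q p≢c q≢c) ⟩
      h q c ∙ h p c ∙ h p q ∙ (Φ p C ∙ Φ q C)
        ≈⟨ solve M ⟩
      h q c ∙ h p c ∙ (h p q ∙ Φ p C ∙ Φ q C)
        ≈⟨ ∙-congˡ (Φ-yang-baxter pqC!) ⟩
      h q c ∙ h p c ∙ (Φ q C ∙ Φ p C ∙ h p q)
        ≈⟨ solve M ⟩
      h q c ∙ (h p c ∙ Φ q C) ∙ Φ p C ∙ h p q
        ≈⟨ ∙-congʳ (∙-congʳ (∙-congˡ hpc-past-ΦqC)) ⟩
      h q c ∙ (Φ q C ∙ h p c) ∙ Φ p C ∙ h p q
        ≈⟨ solve M ⟩
      h q c ∙ Φ q C ∙ (h p c ∙ Φ p C) ∙ h p q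
        ∎
      where
      pqC! : Unique (p ∷ q ∷ C)
      pqC! = (p≢q ∷ p∉C) ∷ q∉C ∷ C!
      hqc-past-ΦpC : h q c ∙ Φ p C ≈ Φ p C ∙ h q c
      hqc-past-ΦpC = h-commutes-Φ (≢-sym p≢q ∷ q∉C) (≢-sym p≢c ∷ c∉C)
      hpc-past-ΦqC : h p c ∙ Φ q C ≈ Φ q C ∙ h p c
      hpc-past-ΦqC = h-commutes-Φ (p≢q ∷ p∉C) (≢-sym q≢c ∷ c∉C)

    Φ-untangle : ∀ {p q C} D E → Unique (p ∷ q ∷ C) →
                 Φ p (D ++ q ∷ C) ∙ Φ q (C ++ p ∷ E) ≈ Φ p D ∙ Φ q C ∙ Φ p C ∙ Φ q E
    Φ-untangle {p} {q} {C} D E pqC!@((p≢q ∷ _) ∷ _) = begin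
      Φ p (D ++ q ∷ C) ∙ Φ q (C ++ p ∷ E)
        ≈⟨ ∙-cong (Φ-++ p D (q ∷ C)) (Φ-++ q C (p ∷ E)) ⟩
      Φ p D ∙ (h p q ∙ Φ p C) ∙ (Φ q C ∙ (h q p ∙ Φ q E))
        ≈⟨ solve M ⟩
      Φ p D ∙ (h p q ∙ Φ p C ∙ Φ q C) ∙ h q p ∙ Φ q E
        ≈⟨ ∙-congʳ (∙-congʳ (∙-congˡ (Φ-yang-baxter pqC!))) ⟩
      Φ p D ∙ (Φ q C ∙ Φ p C ∙ h p q) ∙ h q p ∙ Φ q E
        ≈⟨ solve M ⟩
      Φ p D ∙ Φ q C ∙ Φ p C ∙ (h p q ∙ h q p) ∙ Φ q E
        ≈⟨ ∙-congʳ (∙-congˡ (h-unitary p≢q)) ⟩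
      Φ p D ∙ Φ q C ∙ Φ p C ∙ ε ∙ Φ q E
        ≈⟨ solve M ⟩
      Φ p D ∙ Φ q C ∙ Φ p C ∙ Φ q E
        ∎

    Φ-interleaved-commute : ∀ {p q A B} → Unique (q ∷ A ++ p ∷ B) →
      Φ p (B ++ q ∷ A) ∙ Φ q (A ++ p ∷ B) ≈ Φ q (A ++ p ∷ B) ∙ Φ p (B ++ q ∷ A)
    Φ-interleaved-commute {p} {q} {A} {B} qApB! with Unique-++⁻ (q ∷ A) qApB!
    ... | qA! , pB! , qA#pB = begin
      Φ p (B ++ q ∷ A) ∙ Φ q (A ++ p ∷ B) ≈⟨ Φ-untangle B B pqA! ⟩
      Φ p B ∙ Φ q A ∙ Φ p A ∙ Φ q B       ≈⟨ solve M ⟩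
      (Φ p B ∙ Φ q A) ∙ (Φ p A ∙ Φ q B)   ≈⟨ ∙-cong (Φ-commute pB#qA) (Φ-commute pA#qB) ⟩
      (Φ q A ∙ Φ p B) ∙ (Φ q B ∙ Φ p A)   ≈⟨ solve M ⟩
      Φ q A ∙ Φ p B ∙ Φ q B ∙ Φ p A       ≈⟨ Φ-untangle A A qpB! ⟨
      Φ q (A ++ p ∷ B) ∙ Φ p (B ++ q ∷ A) ∎
      where
      pqA! : Unique (p ∷ q ∷ A)
      pqA! = ¬Any⇒All¬ (q ∷ A) (λ p∈qA → qA#pB (p∈qA , here refl)) ∷ qA!
      qpB! : Unique (q ∷ p ∷ B)
      qpB! = ¬Any⇒All¬ (p ∷ B) (λ q∈pB → qA#pB (here refl , q∈pB)) ∷ pB!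
      pB#qA : Disjoint (p ∷ B) (q ∷ A)
      pB#qA = Disjoint.sym qA#pB
      pA#qB : Disjoint (p ∷ A) (q ∷ B)
      pA#qB (here refl , here p≡q)  = qA#pB (here p≡q , here refl)
      pA#qB (here refl , there p∈B) = Unique.Unique[x∷xs]⇒x∉xs pB! p∈B
      pA#qB (there q∈A , here refl) = Unique.Unique[x∷xs]⇒x∉xs qA! q∈A
      pA#qB (there v∈A , there v∈B) = qA#pB (there v∈A , there v∈B)

module RingProperties {c ℓ} (R : Ring c ℓ) where

  open Ring R renaming (refl to ≈-refl)
  open import Algebra.Properties.Ring R
    using (-‿distribˡ-*; -‿distribʳ-*; -‿involutive; -‿+-comm; -0#≈0#; x[y-z]≈xy-xz; x∙y⁻¹≈ε⇒x≈y)
  open import Relation.Binary.Reasoning.Setoid setoid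
  open import Algebra.Solver.CommutativeMonoid +-commutativeMonoid using (solve; _⊜_; _⊕_)

  Commute : Carrier → Carrier → Set ℓ
  Commute a b = a * b ≈ b * a

  -x*-y≈x*y : ∀ x y → - x * - y ≈ x * y
  -x*-y≈x*y x y = begin
    - x * - y     ≈⟨ -‿distribˡ-* x (- y) ⟨
    - (x * - y)   ≈⟨ -‿cong (-‿distribʳ-* x y) ⟨
    - - (x * y)   ≈⟨ -‿involutive (x * y) ⟩
    x * y         ∎

  x-y-z≈0⇒x≈y+z : ∀ x y z → x - y - z ≈ 0# → x ≈ y + z
  x-y-z≈0⇒x≈y+z x y z x-y-z≈0 = x∙y⁻¹≈ε⇒x≈y x (y + z) (begin
    x - (y + z)     ≈⟨ +-congˡ (-‿+-comm y z) ⟨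
    x + (- y - z)   ≈⟨ +-assoc x (- y) (- z) ⟨
    x - y - z       ≈⟨ x-y-z≈0 ⟩
    0#              ∎)

  1+a*u≈u+a*u : ∀ a u → (1# + a) * u ≈ u + a * u
  1+a*u≈u+a*u a u = trans (distribʳ u 1# a) (+-congʳ (*-identityˡ u))

  u*1+a≈u+u*a : ∀ a u → u * (1# + a) ≈ u + u * a
  u*1+a≈u+u*a a u = trans (distribˡ u 1# a) (+-congʳ (*-identityʳ u))

  commute-1+ˡ : ∀ {a b} → Commute a b → Commute (1# + a) b
  commute-1+ˡ {a} {b} ab≈ba = begin
    (1# + a) * b  ≈⟨ 1+a*u≈u+a*u a b ⟩
    b + a * b     ≈⟨ +-congˡ ab≈ba ⟩
    b + b * a     ≈⟨ u*1+a≈u+u*a a b ⟨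
    b * (1# + a)  ∎

  commute-1+ : ∀ {a b} → Commute a b → Commute (1# + a) (1# + b)
  commute-1+ ab≈ba = commute-1+ˡ (sym (commute-1+ˡ (sym ab≈ba)))

  commute-negˡ : ∀ {a b} → Commute a b → Commute (- a) b
  commute-negˡ {a} {b} ab≈ba = begin
    - a * b    ≈⟨ -‿distribˡ-* a b ⟨
    - (a * b)  ≈⟨ -‿cong ab≈ba ⟩
    - (b * a)  ≈⟨ -‿distribʳ-* b a ⟩
    b * - a    ∎

  commute-1- : ∀ {a b} → Commute a b → Commute (1# - a) (1# - b)
  commute-1- ab≈ba = commute-1+ (commute-negˡ (sym (commute-negˡ (sym ab≈ba))))

  [1+a][1-a]≈1 : ∀ {a} → a * a ≈ 0# → (1# + a) * (1# - a) ≈ 1#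
  [1+a][1-a]≈1 {a} a²≈0 = begin
    (1# + a) * (1# - a)         ≈⟨ 1+a*u≈u+a*u a (1# - a) ⟩
    (1# - a) + a * (1# - a)     ≈⟨ +-congˡ (x[y-z]≈xy-xz a 1# a) ⟩
    (1# - a) + (a * 1# - a * a) ≈⟨ +-congˡ (+-cong (*-identityʳ a) (-‿cong a²≈0)) ⟩
    (1# - a) + (a - 0#)         ≈⟨ +-congˡ (trans (+-congˡ -0#≈0#) (+-identityʳ a)) ⟩
    (1# - a) + a                ≈⟨ +-assoc 1# (- a) a ⟩
    1# + (- a + a)              ≈⟨ +-congˡ (-‿inverseˡ a) ⟩
    1# + 0#                     ≈⟨ +-identityʳ 1# ⟩
    1#                          ∎

  [1+a][1+b]≈1+a+b+ab : ∀ a b → (1# + a) * (1# + b) ≈ 1# + a + b + a * b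
  [1+a][1+b]≈1+a+b+ab a b = begin
    (1# + a) * (1# + b)        ≈⟨ u*1+a≈u+u*a b (1# + a) ⟩
    (1# + a) + (1# + a) * b    ≈⟨ +-congˡ (1+a*u≈u+a*u a b) ⟩
    (1# + a) + (b + a * b)     ≈⟨ +-assoc (1# + a) b (a * b) ⟨
    1# + a + b + a * b         ∎

  [1+a][1+b][1+c]-expand : ∀ a b c → (1# + a) * (1# + b) * (1# + c) ≈
                           (1# + a + b + a * b) + (c + a * c + b * c + a * b * c)
  [1+a][1+b][1+c]-expand a b c = begin
    (1# + a) * (1# + b) * (1# + c)
      ≈⟨ u*1+a≈u+u*a c _ ⟩
    (1# + a) * (1# + b) + (1# + a) * (1# + b) * c
      ≈⟨ +-cong ([1+a][1+b]≈1+a+b+ab a b) (*-congʳ ([1+a][1+b]≈1+a+b+ab a b)) ⟩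
    (1# + a + b + a * b) + (1# + a + b + a * b) * c
      ≈⟨ +-congˡ (distribʳ c (1# + a + b) (a * b)) ⟩
    (1# + a + b + a * b) + ((1# + a + b) * c + a * b * c)
      ≈⟨ +-congˡ (+-congʳ (trans (distribʳ c (1# + a) b) (+-congʳ (1+a*u≈u+a*u a c)))) ⟩
    (1# + a + b + a * b) + (c + a * c + b * c + a * b * c) ∎

  xbz≈zbx : ∀ {x b z} → x * x ≈ 0# → x * z ≈ z * b + b * x → z * x ≈ x * b + b * z →
            x * b * z ≈ z * b * x
  xbz≈zbx {x} {b} {z} x²≈0 xz≈zb+bx zx≈xb+bz = trans xbz≈xzx (sym zbx≈xzx)
    where
    xbz≈xzx : x * b * z ≈ x * z * x
    xbz≈xzx = begin
      x * b * z                  ≈⟨ *-assoc x b z ⟩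
      x * (b * z)                ≈⟨ +-identityˡ _ ⟨
      0# + x * (b * z)           ≈⟨ +-congʳ (trans (*-congʳ x²≈0) (zeroˡ b)) ⟨
      x * x * b + x * (b * z)    ≈⟨ +-congʳ (*-assoc x x b) ⟩
      x * (x * b) + x * (b * z)  ≈⟨ distribˡ x (x * b) (b * z) ⟨
      x * (x * b + b * z)        ≈⟨ *-congˡ zx≈xb+bz ⟨
      x * (z * x)                ≈⟨ *-assoc x z x ⟨
      x * z * x                  ∎
    zbx≈xzx : z * b * x ≈ x * z * x
    zbx≈xzx = begin
      z * b * x                  ≈⟨ +-identityʳ _ ⟨
      z * b * x + 0#             ≈⟨ +-congˡ (trans (*-assoc b x x) (trans (*-congˡ x²≈0) (zeroʳ b))) ⟨
      z * b * x + b * x * x      ≈⟨ distribʳ x (z * b) (b * x) ⟨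
      (z * b + b * x) * x        ≈⟨ *-congʳ xz≈zb+bx ⟨
      x * z * x                  ∎

  yang-baxter-1+ : ∀ {x b z} → x * x ≈ 0# → x * z ≈ z * b + b * x → z * x ≈ x * b + b * z →
                   (1# + x) * (1# + b) * (1# + z) ≈ (1# + z) * (1# + b) * (1# + x)
  yang-baxter-1+ {x} {b} {z} x²≈0 xz≈zb+bx zx≈xb+bz = begin
    (1# + x) * (1# + b) * (1# + z)
      ≈⟨ [1+a][1+b][1+c]-expand x b z ⟩
    (1# + x + b + x * b) + (z + x * z + b * z + x * b * z)
      ≈⟨ +-congˡ (+-cong (+-congʳ (+-congˡ xz≈zb+bx)) (xbz≈zbx x²≈0 xz≈zb+bx zx≈xb+bz)) ⟩
    (1# + x + b + x * b) + (z + (z * b + b * x) + b * z + z * b * x)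
      ≈⟨ solve 9 (λ o x b z xb zb bx bz t →
           (((o ⊕ x) ⊕ b) ⊕ xb) ⊕ (((z ⊕ (zb ⊕ bx)) ⊕ bz) ⊕ t) ⊜
           (((o ⊕ z) ⊕ b) ⊕ zb) ⊕ (((x ⊕ (xb ⊕ bz)) ⊕ bx) ⊕ t))
           ≈-refl 1# x b z (x * b) (z * b) (b * x) (b * z) (z * b * x) ⟩
    (1# + z + b + z * b) + (x + (x * b + b * z) + b * x + z * b * x)
      ≈⟨ +-congˡ (+-congʳ (+-congʳ (+-congˡ zx≈xb+bz))) ⟨
    (1# + z + b + z * b) + (x + z * x + b * x + z * b * x)
      ≈⟨ [1+a][1+b][1+c]-expand z b x ⟨
    (1# + z) * (1# + b) * (1# + x) ∎

open import Defs

𝓔-ring : ℕ → Ring 0ℓ 0ℓ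
𝓔-ring n = record
  { Carrier = Term n ; _≈_ = _≈_ ; _+_ = _⊕_ ; _*_ = _⊗_ ; -_ = ⊖_ ; 0# = 𝟘 ; 1# = 𝟙
  ; isRing = record
    { +-isAbelianGroup = record
      { isGroup = record
        { isMonoid = record
          { isSemigroup = record
            { isMagma = record
              { isEquivalence = record { refl = refl≈ ; sym = sym≈ ; trans = trans≈ }
              ; ∙-cong = ⊕-cong }
            ; assoc = ⊕-assoc }
          ; identity = ⊕-idˡ , λ x → trans≈ (⊕-comm x 𝟘) (⊕-idˡ x) }
        ; inverse = ⊖-invˡ , λ x → trans≈ (⊕-comm x (⊖ x)) (⊖-invˡ x)
        ; ⁻¹-cong = ⊖-cong }
      ; comm = ⊕-comm }
    ; *-cong = ⊗-cong
    ; *-assoc = ⊗-assoc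
    ; *-identity = ⊗-idˡ , ⊗-idʳ
    ; distrib = distribˡ , distribʳ
    } }

module _ {n : ℕ} where

  open RingProperties (𝓔-ring n)
  open import Algebra.Properties.Ring (𝓔-ring n) using (+-inverseʳ-unique; -‿distribˡ-*; -‿distribʳ-*)

  gen-antisym : ∀ i j (i≢j : i ≢ j) → gen j i (≢-sym i≢j) ≈ ⊖ gen i j i≢j
  gen-antisym i j i≢j =
    +-inverseʳ-unique (gen i j i≢j) (gen j i (≢-sym i≢j)) (rel-i i j i≢j (≢-sym i≢j))

  gen-flip-⊗ : ∀ i j k l (i≢j : i ≢ j) (k≢l : k ≢ l) →
               gen j i (≢-sym i≢j) ⊗ gen l k (≢-sym k≢l) ≈ gen i j i≢j ⊗ gen k l k≢l
  gen-flip-⊗ i j k l i≢j k≢l =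
    trans≈ (⊗-cong (gen-antisym i j i≢j) (gen-antisym k l k≢l))
           (-x*-y≈x*y (gen i j i≢j) (gen k l k≢l))

  three-term : ∀ i j k (i≢j : i ≢ j) (j≢k : j ≢ k) (k≢i : k ≢ i) →
               gen i j i≢j ⊗ gen j k j≢k ≈
               gen j k j≢k ⊗ gen i k (≢-sym k≢i) ⊕ gen i k (≢-sym k≢i) ⊗ gen i j i≢j
  three-term i j k i≢j j≢k k≢i = x-y-z≈0⇒x≈y+z _ _ _ (trans≈
    (⊕-cong (⊕-cong refl≈ -[jk⊗ik]≈jk⊗ki) -[ik⊗ij]≈ki⊗ij)
    (rel-iii i j k i≢j j≢k k≢i))
    where
    ki≈-ik : gen k i k≢i ≈ ⊖ gen i k (≢-sym k≢i)
    ki≈-ik = gen-antisym i k (≢-sym k≢i)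
    -[jk⊗ik]≈jk⊗ki : ⊖ (gen j k j≢k ⊗ gen i k (≢-sym k≢i)) ≈ gen j k j≢k ⊗ gen k i k≢i
    -[jk⊗ik]≈jk⊗ki = trans≈ (-‿distribʳ-* _ _) (⊗-cong refl≈ (sym≈ ki≈-ik))
    -[ik⊗ij]≈ki⊗ij : ⊖ (gen i k (≢-sym k≢i) ⊗ gen i j i≢j) ≈ gen k i k≢i ⊗ gen i j i≢j
    -[ik⊗ij]≈ki⊗ij = trans≈ (-‿distribˡ-* _ _) (⊗-cong (sym≈ ki≈-ik) refl≈)

  three-term′ : ∀ i j k (i≢j : i ≢ j) (j≢k : j ≢ k) (k≢i : k ≢ i) →
                gen j i (≢-sym i≢j) ⊗ gen k j (≢-sym j≢k) ≈
                gen k j (≢-sym j≢k) ⊗ gen k i k≢i ⊕ gen k i k≢i ⊗ gen j i (≢-sym i≢j)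
  three-term′ i j k i≢j j≢k k≢i = trans≈ (gen-flip-⊗ i j j k i≢j j≢k) (trans≈
    (three-term i j k i≢j j≢k k≢i)
    (sym≈ (⊕-cong (gen-flip-⊗ j k i k j≢k (≢-sym k≢i)) (gen-flip-⊗ i k i j (≢-sym k≢i) i≢j))))

  factor-≢ : ∀ {p i : Fin n} (i≢p : i ≢ p) → factor p i ≡ 𝟙 ⊕ gen i p i≢p
  factor-≢ {p} {i} i≢p with i ≟ p
  ... | yes i≡p = ⊥-elim (i≢p i≡p)
  ... | no _    = refl

  factor-unitary : ∀ {p q : Fin n} → p ≢ q → factor p q ⊗ factor q p ≈ 𝟙
  factor-unitary {p} {q} p≢q rewrite factor-≢ (≢-sym p≢q) | factor-≢ p≢q =
    trans≈ (⊗-cong refl≈ (⊕-cong refl≈ (gen-antisym q p (≢-sym p≢q))))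
           ([1+a][1-a]≈1 (rel-ii q p (≢-sym p≢q)))

  factor-yang-baxter : ∀ {p q c : Fin n} → p ≢ q → p ≢ c → q ≢ c →
    factor p q ⊗ factor p c ⊗ factor q c ≈ factor q c ⊗ factor p c ⊗ factor p q
  factor-yang-baxter {p} {q} {c} p≢q p≢c q≢c
    rewrite factor-≢ (≢-sym p≢q) | factor-≢ (≢-sym p≢c) | factor-≢ (≢-sym q≢c) =
    yang-baxter-1+ (rel-ii q p (≢-sym p≢q))
      (three-term′ p q c p≢q q≢c (≢-sym p≢c))
      (three-term c q p (≢-sym q≢c) (≢-sym p≢q) p≢c)

  -- factor p p = 𝟙.
  factor-local : ∀ {x c y d : Fin n} → x ≢ y → x ≢ d → c ≢ y → c ≢ d →
                 factor x c ⊗ factor y d ≈ factor y d ⊗ factor x c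
  factor-local {x} {c} {y} {d} x≢y x≢d c≢y c≢d with c ≟ x | d ≟ y
  ... | yes _   | _       = trans≈ (⊗-idˡ _) (sym≈ (⊗-idʳ _))
  ... | no _    | yes _   = trans≈ (⊗-idʳ _) (sym≈ (⊗-idˡ _))
  ... | no c≢x  | no d≢y  = commute-1+ (rel-iv c x d y c≢x d≢y c≢d c≢y x≢d x≢y)

module _ {n : ℕ} where

  Descending : List (Fin n) → Set
  Descending = AllPairs _>_

  allFin↓ : List (Fin n)
  allFin↓ = reverse (allFin n)

  allFin↓-descending : Descending allFin↓
  allFin↓-descending = AllPairs-reverse⁺ (AllPairs.tabulate⁺-< (λ i<j → i<j))

  ∈-allFin↓ : ∀ i → i ∈ allFin↓
  ∈-allFin↓ i = Any.reverse⁺ (∈-allFin i)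

  descending-split : ∀ {m xs} → Descending xs → m ∈ xs →
                     xs ≡ filter (m <?_) xs ++ m ∷ filter (_<? m) xs
  descending-split {m} {m ∷ xs} (m>xs ∷ _) (here refl) =
    ≡.sym (≡.cong₂ (λ ys zs → ys ++ m ∷ zs) no-larger all-smaller)
    where
    no-larger : filter (m <?_) (m ∷ xs) ≡ []
    no-larger = ≡.trans (filter-reject (m <?_) (<-irrefl refl)) (filter-none (m <?_) (All.map <-asym m>xs))
    all-smaller : filter (_<? m) (m ∷ xs) ≡ xs
    all-smaller = ≡.trans (filter-reject (_<? m) (<-irrefl refl)) (filter-all (_<? m) m>xs)
  descending-split {m} {x ∷ xs} (x>xs ∷ xs↓) (there m∈xs)
    rewrite filter-accept (m <?_) {x} {xs} (All.lookup x>xs m∈xs)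
          | filter-reject (_<? m) {x} {xs} (<-asym (All.lookup x>xs m∈xs)) =
    ≡.cong (x ∷_) (descending-split xs↓ m∈xs)

  filter-allFin↓-split : ∀ {r} {P : Pred (Fin n) r} (P? : Decidable P) {m} → P m →
    filter P? allFin↓ ≡ filter (m <?_) (filter P? allFin↓) ++ m ∷ filter (_<? m) (filter P? allFin↓)
  filter-allFin↓-split P? {m} Pm =
    descending-split (AllPairs.filter⁺ P? allFin↓-descending) (∈-filter⁺ P? (∈-allFin↓ m) Pm)

  -- Data.Fin's _<?_ unfolds to that of ℕ on toℕ, so dunklOrder p is definitionally
  -- filter (_<? p) allFin↓ ++ filter (p <?_) allFin↓.
  dunklOrder-split : ∀ {p q : Fin n} → p < q →
    ∃₂ λ A B → dunklOrder p ≡ B ++ q ∷ A × dunklOrder q ≡ A ++ p ∷ B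
  dunklOrder-split {p} {q} p<q =
    A , below-p ++ above-q ,
    ≡.trans (≡.cong (below-p ++_) above-p-split) (≡.sym (++-assoc below-p above-q (q ∷ A))) ,
    ≡.trans (≡.cong (_++ above-q) below-q-split) (++-assoc A (p ∷ below-p) above-q)
    where
    open ≡-Reasoning
    below-p above-q A : List (Fin n)
    below-p = filter (_<? p) allFin↓
    above-q = filter (q <?_) allFin↓
    A = filter (_<? q) (filter (p <?_) allFin↓)
    above-p-split : filter (p <?_) allFin↓ ≡ above-q ++ q ∷ A
    above-p-split = begin
      filter (p <?_) allFin↓
        ≡⟨ filter-allFin↓-split (p <?_) p<q ⟩
      filter (q <?_) (filter (p <?_) allFin↓) ++ q ∷ A
        ≡⟨ ≡.cong (_++ q ∷ A) (filter-filter-⊆ (q <?_) (p <?_) (<-trans p<q) allFin↓) ⟩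
      above-q ++ q ∷ A ∎
    below-q-split : filter (_<? q) allFin↓ ≡ A ++ p ∷ below-p
    below-q-split = begin
      filter (_<? q) allFin↓
        ≡⟨ filter-allFin↓-split (_<? q) p<q ⟩
      filter (p <?_) (filter (_<? q) allFin↓) ++ p ∷ filter (_<? p) (filter (_<? q) allFin↓)
        ≡⟨ ≡.cong₂ (λ ys zs → ys ++ p ∷ zs)
             (filter-filter-comm (p <?_) (_<? q) allFin↓)
             (filter-filter-⊆ (_<? p) (_<? q) (λ i<p → <-trans i<p p<q) allFin↓) ⟩
      A ++ p ∷ below-p ∎

  dunklOrder-unique : ∀ (p : Fin n) → Unique (p ∷ dunklOrder p)
  dunklOrder-unique p = p∉ ∷ Unique.++⁺ below! above! below#above
    where
    allFin↓! : Unique allFin↓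
    allFin↓! = AllPairs.map (λ i>j → ≢-sym (<⇒≢ i>j)) allFin↓-descending
    below! : Unique (filter (_<? p) allFin↓)
    below! = Unique.filter⁺ (_<? p) allFin↓!
    above! : Unique (filter (p <?_) allFin↓)
    above! = Unique.filter⁺ (p <?_) allFin↓!
    p∉ : All (p ≢_) (dunklOrder p)
    p∉ = All.++⁺ (All.map (λ i<p → ≢-sym (<⇒≢ i<p)) (all-filter (_<? p) allFin↓))
                 (All.map <⇒≢ (all-filter (p <?_) allFin↓))
    below#above : Disjoint (filter (_<? p) allFin↓) (filter (p <?_) allFin↓)
    below#above (i∈below , i∈above) = <-asym
      (proj₂ (∈-filter⁻ (_<? p) {xs = allFin↓} i∈below))
      (proj₂ (∈-filter⁻ (p <?_) {xs = allFin↓} i∈above))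

module _ {n : ℕ} where

  open RingProperties (𝓔-ring n) using (Commute; commute-1-)
  open Products.DunklProducts (Ring.*-monoid (𝓔-ring n)) factor factor-unitary factor-yang-baxter factor-local

  Φ-dunklOrder-commute : ∀ {p q : Fin n} → p < q → Commute (Φ p (dunklOrder p)) (Φ q (dunklOrder q))
  Φ-dunklOrder-commute {p} {q} p<q with dunklOrder-split p<q
  ... | A , B , p-order , q-order rewrite p-order | q-order =
    Φ-interleaved-commute (≡.subst (λ L → Unique (q ∷ L)) q-order (dunklOrder-unique q))

  κ-commute : ∀ {p q : Fin n} → p < q → Commute (κ p) (κ q)
  κ-commute p<q = commute-1- (Φ-dunklOrder-commute p<q)

theorem2p2 : (n : ℕ) → 1 ≤ n → (p q : Fin n) → κ p ⊗ κ q ≈ κ q ⊗ κ p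
theorem2p2 n _ p q with <-cmp p q
... | tri< p<q _ _ = κ-commute p<q
... | tri≈ _ refl _ = refl≈
... | tri> _ _ q<p = sym≈ (κ-commute q<p)
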